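{- Let $G=(V,E)$ be a finite simple graph and let $e=\{u,v\}\in E$. Then, as an identity of rational functions in $x$, \begin{align*} D(G,x) = D(G-e,x)+\frac{x}{x-1}\Big[&D((G-e)/u,x)+D((G-e)/v,x)-D(G/u,x)-D(G/v,x)\\ &-D(G-N_G[u],x)-D(G-N_G[v],x)\\ &+D((G-e)-N_{G-e}[u],x)+D((G-e)-N_{G-e}[v],x)\Big]. \end{align*}
   Context: For a finite simple graph $G=(V,E)$, the domination polynomial is $D(G,x)=\sum_{W\subseteq V,\ N_G[W]=V}x^{|W|}$, where $N_G[W]$ is the closed neighborhood of $W$; the graph with no vertices has $D=1$. Graph operations: - $G-e$ deletes the edge $e$. - For a vertex $w$, $H/w$ deletes $w$ from $H$ and adds an edge between every pair of non-adjacent neighbors of $w$ in $H$. - $H-N_H[w]$ deletes all vertices of the closed neighborhood of $w$ in $H$. -}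

module Defs where

open import Data.Nat using (ℕ; zero; suc)
open import Data.Fin using (Fin; zero; suc; _≟_)
open import Data.Bool using (Bool; true; false; _∧_; _∨_; not; if_then_else_)
open import Data.List using (List; []; _∷_; map; _++_; foldr)
open import Relation.Nullary.Decidable using (⌊_⌋)
open import Relation.Binary.PropositionalEquality using (_≡_)
open import Data.Rational using (ℚ; 0ℚ; 1ℚ; _+_; _*_)

_==_ : ∀ {n} → Fin n → Fin n → Bool
a == b = ⌊ a ≟ b ⌋

allF : ∀ {n} → (Fin n → Bool) → Bool
allF {zero}  p = true
allF {suc n} p = p zero ∧ allF (λ i → p (suc i))

anyF : ∀ {n} → (Fin n → Bool) → Bool
anyF {zero}  p = false
anyF {suc n} p = p zero ∨ anyF (λ i → p (suc i))

card : ∀ {n} → (Fin n → Bool) → ℕ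
card {zero}  s = 0
card {suc n} s = (if s zero then 1 else 0) Data.Nat.+ card (λ i → s (suc i))

subsets : (n : ℕ) → List (Fin n → Bool)
subsets zero    = (λ ()) ∷ []
subsets (suc n) =
  map (λ s → λ { zero → false ; (suc i) → s i }) (subsets n) ++
  map (λ s → λ { zero → true  ; (suc i) → s i }) (subsets n)

record SimpleGraph (n : ℕ) : Set where
  field
    adj    : Fin n → Fin n → Bool
    sym    : ∀ a b → adj a b ≡ adj b a
    irrefl : ∀ a → adj a a ≡ false
open SimpleGraph public

-- A graph whose vertex set is a subset  vs  of Fin n (used for graphs
-- obtained by vertex deletions).  Only adjacencies between vertices in vs
-- count (see  E ).
record Gr (n : ℕ) : Set where
  constructor mkGr
  field
    vs  : Fin n → Bool
    ad  : Fin n → Fin n → Bool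
open Gr public

E : ∀ {n} → Gr n → Fin n → Fin n → Bool
E H a b = vs H a ∧ vs H b ∧ ad H a b

toGr : ∀ {n} → SimpleGraph n → Gr n
toGr G = mkGr (λ _ → true) (adj G)

deleteEdge : ∀ {n} → Gr n → Fin n → Fin n → Gr n
deleteEdge H u v = mkGr (vs H)
  (λ a b → E H a b ∧ not ((a == u ∧ b == v) ∨ (a == v ∧ b == u)))

contract : ∀ {n} → Gr n → Fin n → Gr n
contract H w = mkGr (λ a → vs H a ∧ not (a == w))
  (λ a b → E H a b ∨ (E H a w ∧ E H w b ∧ not (a == b)))

removeClosedNbhd : ∀ {n} → Gr n → Fin n → Gr n
removeClosedNbhd H w = mkGr (λ a → vs H a ∧ not (a == w ∨ E H w a)) (ad H)

dominating : ∀ {n} → Gr n → (Fin n → Bool) → Bool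
dominating H W =
  allF (λ a → not (W a) ∨ vs H a) ∧
  allF (λ a → not (vs H a) ∨ (W a ∨ anyF (λ b → W b ∧ E H b a)))

_^_ : ℚ → ℕ → ℚ
x ^ zero  = 1ℚ
x ^ suc k = x * (x ^ k)

D : ∀ {n} → Gr n → ℚ → ℚ
D {n} H x = foldr (λ W acc → (if dominating H W then x ^ card W else 0ℚ) + acc)
                  0ℚ (subsets n)

-- Multiplying by x - 1, it suffices to show Σ_W Φ(W) = 0, where Φ(W) = x^|W| times
-- (x-1)(ι_G - ι_{G-e}) - x·(the bracket of the eight indicators), ι_K being the
-- indicator that W dominates K.  We group the vertex sets W by their intersection
-- with {u, v}: each group is W, W+u, W+v, W+u+v with u, v ∉ W (Σsets-pair, used at u
-- and at v).  For such W, whether W ∪ {u if s} ∪ {v if t} dominates one of the ten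
-- graphs depends only on s, t, on whether W dominates u resp. v in G (mu, mv), and on
-- the four truth values R s t = "W ∪ {u if s} ∪ {v if t} dominates all other
-- vertices of G" (module Local).  For these local profiles five finite facts hold,
-- checked by truth tables, and they make the four weighted terms cancel
-- (block-cancels).

module Submission where

open import Data.Nat as ℕ using (ℕ; zero; suc)
open import Data.Nat.Properties using (+-commutativeSemigroup)
open import Algebra.Properties.CommutativeSemigroup +-commutativeSemigroup using (x∙yz≈y∙xz)
open import Data.Fin using (Fin; zero; suc; _≟_)
open import Data.Bool using (Bool; true; false; _∧_; _∨_; not; if_then_else_; T)
open import Data.Bool.Properties
  using (T-∧; ∧-distribˡ-∨; ∧-distribʳ-∨; ∧-identityʳ; ∧-zeroʳ; ∨-zeroʳ; ∧-assoc; ∧-comm)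
open import Data.List using (List; []; _∷_; map; _++_; foldr)
open import Data.Product using (_×_; _,_; proj₁; proj₂; ∃)
open import Data.Sum using (_⊎_; inj₁; inj₂)
open import Data.Empty using (⊥-elim)
open import Data.Unit using (tt)
open import Data.Rational using (ℚ; 0ℚ; 1ℚ; _+_; _-_; _*_; -_; _÷_; 1/_; NonZero)
  renaming (_≟_ to _≟ℚ_)
open import Data.Rational.Properties
  using (+-identityˡ; +-identityʳ; +-assoc; *-zeroˡ; *-zeroʳ; *-identityˡ; *-inverseʳ)
open import Data.Rational.Solver using (module +-*-Solver)
open import Function.Bundles using (Equivalence)
open import Relation.Nullary using (Dec; yes; no)
open import Relation.Nullary.Decidable using (⌊_⌋; toWitness)
open import Relation.Binary.Definitions using (DecidableEquality)
open import Relation.Binary.PropositionalEquality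
open import Defs hiding (sym)
open +-*-Solver

module TruthTable {A : Set} (_≟A_ : DecidableEquality A) where

  Fn : ℕ → Set
  Fn zero    = A
  Fn (suc k) = Bool → Fn k

  Agree : ∀ k → Fn k → Fn k → Set
  Agree zero    f g = f ≡ g
  Agree (suc k) f g = ∀ b → Agree k (f b) (g b)

  agree? : ∀ k → Fn k → Fn k → Bool
  agree? zero    f g = ⌊ f ≟A g ⌋
  agree? (suc k) f g = agree? k (f false) (g false) ∧ agree? k (f true) (g true)

  decide : ∀ k (f g : Fn k) → T (agree? k f g) → Agree k f g
  decide zero    f g ok       = toWitness ok
  decide (suc k) f g ok false = decide k _ _ (proj₁ (Equivalence.to T-∧ ok))
  decide (suc k) f g ok true  = decide k _ _ (proj₂ (Equivalence.to T-∧ ok))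

open TruthTable Data.Bool._≟_ using (decide)

∧-split : ∀ {a b} → a ∧ b ≡ true → (a ≡ true) × (b ≡ true)
∧-split {true} {true} _ = refl , refl

∨-split : ∀ {a b} → a ∨ b ≡ true → (a ≡ true) ⊎ (b ≡ true)
∨-split {true}  _ = inj₁ refl
∨-split {false} p = inj₂ p

∨-introʳ : ∀ a {b} → b ≡ true → a ∨ b ≡ true
∨-introʳ true  _ = refl
∨-introʳ false p = p

bool-ext : ∀ {a b : Bool} → (a ≡ true → b ≡ true) → (b ≡ true → a ≡ true) → a ≡ b
bool-ext {true}  {true}  _ _ = refl
bool-ext {true}  {false} f _ = sym (f refl)
bool-ext {false} {true}  _ g = g refl
bool-ext {false} {false} _ _ = refl

false≢true : false ≢ true
false≢true ()

==-refl : ∀ {n} (a : Fin n) → a == a ≡ true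
==-refl a with a ≟ a
... | yes _  = refl
... | no a≢a = ⊥-elim (a≢a refl)

==-≢ : ∀ {n} {a b : Fin n} → a ≢ b → a == b ≡ false
==-≢ {a = a} {b} a≢b with a ≟ b
... | yes a≡b = ⊥-elim (a≢b a≡b)
... | no  _   = refl

allF-elim : ∀ {n} {p : Fin n → Bool} → allF p ≡ true → ∀ a → p a ≡ true
allF-elim {suc n} {p} h zero    = proj₁ (∧-split {p zero} h)
allF-elim {suc n} {p} h (suc a) = allF-elim (proj₂ (∧-split {p zero} h)) a

allF-intro : ∀ {n} {p : Fin n → Bool} → (∀ a → p a ≡ true) → allF p ≡ true
allF-intro {zero}  h = refl
allF-intro {suc n} h rewrite h zero = allF-intro (λ a → h (suc a))

anyF-elim : ∀ {n} {p : Fin n → Bool} → anyF p ≡ true → ∃ λ a → p a ≡ true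
anyF-elim {suc n} {p} h with ∨-split {p zero} h
... | inj₁ p0 = zero , p0
... | inj₂ ps with anyF-elim ps
...   | a , pa = suc a , pa

anyF-intro : ∀ {n} {p : Fin n → Bool} a → p a ≡ true → anyF p ≡ true
anyF-intro {suc n} zero    h rewrite h = refl
anyF-intro {suc n} {p} (suc a) h = ∨-introʳ (p zero) (anyF-intro a h)

allF-cong : ∀ {n} {p q : Fin n → Bool} → (∀ a → p a ≡ q a) → allF p ≡ allF q
allF-cong {zero}  h = refl
allF-cong {suc n} h = cong₂ _∧_ (h zero) (allF-cong (λ a → h (suc a)))

anyF-cong : ∀ {n} {p q : Fin n → Bool} → (∀ a → p a ≡ q a) → anyF p ≡ anyF q
anyF-cong {zero}  h = refl
anyF-cong {suc n} h = cong₂ _∨_ (h zero) (anyF-cong (λ a → h (suc a)))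

allF-refute : ∀ {n} {p : Fin n → Bool} a → p a ≡ false → allF p ≡ false
allF-refute {p = p} a h = bool-ext (λ all → trans (sym h) (allF-elim all a)) λ ()

anyF-none : ∀ {n} {p : Fin n → Bool} → anyF p ≡ false → ∀ a → p a ≡ false
anyF-none {p = p} h a = bool-ext (λ pa → trans (sym h) (anyF-intro a pa)) λ ()

allF-∧ : ∀ {n} (p q : Fin n → Bool) → allF (λ a → p a ∧ q a) ≡ allF p ∧ allF q
allF-∧ {zero}  p q = refl
allF-∧ {suc n} p q rewrite allF-∧ (λ a → p (suc a)) (λ a → q (suc a)) =
  interchange (p zero) (q zero) _ _
  where
  interchange : ∀ a b c d → (a ∧ b) ∧ (c ∧ d) ≡ (a ∧ c) ∧ (b ∧ d)
  interchange = decide 4 _ _ tt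

anyF-∨ : ∀ {n} (p q : Fin n → Bool) → anyF (λ a → p a ∨ q a) ≡ anyF p ∨ anyF q
anyF-∨ {zero}  p q = refl
anyF-∨ {suc n} p q rewrite anyF-∨ (λ a → p (suc a)) (λ a → q (suc a)) =
  interchange (p zero) (q zero) _ _
  where
  interchange : ∀ a b c d → (a ∨ b) ∨ (c ∨ d) ≡ (a ∨ c) ∨ (b ∨ d)
  interchange = decide 4 _ _ tt

anyF-∧ʳ : ∀ {n} (p : Fin n → Bool) c → anyF (λ a → p a ∧ c) ≡ anyF p ∧ c
anyF-∧ʳ {zero}  p c = refl
anyF-∧ʳ {suc n} p c rewrite anyF-∧ʳ (λ a → p (suc a)) c =
  sym (∧-distribʳ-∨ c (p zero) (anyF (λ a → p (suc a))))

VertexSet : ℕ → Set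
VertexSet n = Fin n → Bool

_[_≔_] : ∀ {n} → VertexSet n → Fin n → Bool → VertexSet n
(W [ u ≔ b ]) a = if a == u then b else W a

set-at : ∀ {n} (W : VertexSet n) u b → (W [ u ≔ b ]) u ≡ b
set-at W u b = cong (if_then b else W u) (==-refl u)

set-other : ∀ {n} (W : VertexSet n) {u a} b → a ≢ u → (W [ u ≔ b ]) a ≡ W a
set-other W b a≢u = cong (if_then b else _) (==-≢ a≢u)

==-suc : ∀ {n} (a b : Fin n) → (suc a == suc b) ≡ (a == b)
==-suc a b with a ≟ b
... | yes _ = refl
... | no  _ = refl

bit : Bool → ℕ
bit b = if b then 1 else 0

card-cong : ∀ {n} {V W : VertexSet n} → V ≗ W → card V ≡ card W
card-cong {zero}  h = refl
card-cong {suc n} h = cong₂ ℕ._+_ (cong bit (h zero)) (card-cong (λ a → h (suc a)))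

card-set : ∀ {n} (W : VertexSet n) u b → W u ≡ false → card (W [ u ≔ b ]) ≡ bit b ℕ.+ card W
card-set W zero    b Wu rewrite Wu = refl
card-set W (suc u) b Wu = begin
    bit (W zero) ℕ.+ card (λ a → (W [ suc u ≔ b ]) (suc a))
  ≡⟨ cong (bit (W zero) ℕ.+_) (card-cong λ a → cong (if_then b else W (suc a)) (==-suc a u)) ⟩
    bit (W zero) ℕ.+ card ((λ a → W (suc a)) [ u ≔ b ])
  ≡⟨ cong (bit (W zero) ℕ.+_) (card-set (λ a → W (suc a)) u b Wu) ⟩
    bit (W zero) ℕ.+ (bit b ℕ.+ card (λ a → W (suc a)))
  ≡⟨ x∙yz≈y∙xz (bit (W zero)) (bit b) _ ⟩
    bit b ℕ.+ card W ∎
  where open ≡-Reasoning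

sumList : ∀ {n} → List (VertexSet n) → (VertexSet n → ℚ) → ℚ
sumList xs f = foldr (λ W acc → f W + acc) 0ℚ xs

Σsets : ∀ n → (VertexSet n → ℚ) → ℚ
Σsets n = sumList (subsets n)

sumList-cong : ∀ {n} (xs : List (VertexSet n)) {f g : VertexSet n → ℚ} → (∀ W → f W ≡ g W) →
  sumList xs f ≡ sumList xs g
sumList-cong []       h = refl
sumList-cong (W ∷ xs) h = cong₂ _+_ (h W) (sumList-cong xs h)

sumList-+ : ∀ {n} (xs : List (VertexSet n)) (f g : VertexSet n → ℚ) →
  sumList xs (λ W → f W + g W) ≡ sumList xs f + sumList xs g
sumList-+ []       f g = refl
sumList-+ (W ∷ xs) f g = trans (cong (f W + g W +_) (sumList-+ xs f g))
  (solve 4 (λ a b c d → (a :+ b) :+ (c :+ d) := (a :+ c) :+ (b :+ d)) refl (f W) (g W) _ _)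

sumList-- : ∀ {n} (xs : List (VertexSet n)) (f g : VertexSet n → ℚ) →
  sumList xs (λ W → f W - g W) ≡ sumList xs f - sumList xs g
sumList-- []       f g = refl
sumList-- (W ∷ xs) f g = trans (cong (f W - g W +_) (sumList-- xs f g))
  (solve 4 (λ a b c d → (a :- b) :+ (c :- d) := (a :+ c) :- (b :+ d)) refl (f W) (g W) _ _)

sumList-* : ∀ {n} (xs : List (VertexSet n)) c (f : VertexSet n → ℚ) →
  sumList xs (λ W → c * f W) ≡ c * sumList xs f
sumList-* []       c f = sym (*-zeroʳ c)
sumList-* (W ∷ xs) c f = trans (cong (c * f W +_) (sumList-* xs c f))
  (solve 3 (λ c a b → c :* a :+ c :* b := c :* (a :+ b)) refl c (f W) _)

sumList-0 : ∀ {n} (xs : List (VertexSet n)) → sumList xs (λ _ → 0ℚ) ≡ 0ℚ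
sumList-0 []       = refl
sumList-0 (W ∷ xs) = cong (0ℚ +_) (sumList-0 xs)

sumList-++ : ∀ {n} (xs ys : List (VertexSet n)) f → sumList (xs ++ ys) f ≡ sumList xs f + sumList ys f
sumList-++ []       ys f = sym (+-identityˡ _)
sumList-++ (W ∷ xs) ys f = trans (cong (f W +_) (sumList-++ xs ys f)) (sym (+-assoc (f W) _ _))

sumList-map : ∀ {m n} (h : VertexSet m → VertexSet n) xs f → sumList (map h xs) f ≡ sumList xs (λ W → f (h W))
sumList-map h []       f = refl
sumList-map h (W ∷ xs) f = cong (f (h W) +_) (sumList-map h xs f)

Respects≗ : ∀ {n} → (VertexSet n → ℚ) → Set
Respects≗ f = ∀ {V W} → V ≗ W → f V ≡ f W

_◃_ : ∀ {n} → Bool → VertexSet n → VertexSet (suc n)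
(b ◃ W) zero    = b
(b ◃ W) (suc a) = W a

Σsets-suc : ∀ {n} (f : VertexSet (suc n) → ℚ) → Respects≗ f →
  Σsets (suc n) f ≡ Σsets n (λ W → f (false ◃ W)) + Σsets n (λ W → f (true ◃ W))
Σsets-suc {n} f f-resp = begin
    Σsets (suc n) f
  ≡⟨ sumList-++ (map _ (subsets n)) (map _ (subsets n)) f ⟩
    sumList (map _ (subsets n)) f + sumList (map _ (subsets n)) f
  ≡⟨ cong₂ _+_ (half false _ λ W → λ { zero → refl ; (suc a) → refl })
               (half true  _ λ W → λ { zero → refl ; (suc a) → refl }) ⟩
    Σsets n (λ W → f (false ◃ W)) + Σsets n (λ W → f (true ◃ W)) ∎
  where
  open ≡-Reasoning
  half : ∀ b (h : VertexSet n → VertexSet (suc n)) → (∀ W → h W ≗ b ◃ W) →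
    sumList (map h (subsets n)) f ≡ Σsets n (λ W → f (b ◃ W))
  half b h h≗ = trans (sumList-map h (subsets n) f) (sumList-cong (subsets n) λ W → f-resp (h≗ W))

pairAt : ∀ {n} → Fin n → (VertexSet n → ℚ) → VertexSet n → ℚ
pairAt u f W = if W u then 0ℚ else f W + f (W [ u ≔ true ])

pairAt-present : ∀ {n} (u : Fin n) f W → W u ≡ true → pairAt u f W ≡ 0ℚ
pairAt-present u f W u∈W rewrite u∈W = refl

pairAt-absent : ∀ {n} (u : Fin n) f W → W u ≡ false → pairAt u f W ≡ f W + f (W [ u ≔ true ])
pairAt-absent u f W u∉W rewrite u∉W = refl

set-resp : ∀ {n} {V W : VertexSet n} u b → V ≗ W → V [ u ≔ b ] ≗ W [ u ≔ b ]
set-resp u b V≗W a = cong (if a == u then b else_) (V≗W a)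

pairAt-resp : ∀ {n} (u : Fin n) {f} → Respects≗ f → Respects≗ (pairAt u f)
pairAt-resp u {f} f-resp {V} {W} V≗W rewrite V≗W u =
  cong (if W u then 0ℚ else_) (cong₂ _+_ (f-resp V≗W) (f-resp (set-resp u true V≗W)))

Σsets-pair : ∀ {n} (u : Fin n) (f : VertexSet n → ℚ) → Respects≗ f → Σsets n f ≡ Σsets n (pairAt u f)
Σsets-pair {suc n} zero f f-resp = sym (begin
    Σsets (suc n) (pairAt zero f)
  ≡⟨ Σsets-suc (pairAt zero f) (pairAt-resp zero f-resp) ⟩
    Σsets n (λ W → f (false ◃ W) + f ((false ◃ W) [ zero ≔ true ])) + Σsets n (λ _ → 0ℚ)
  ≡⟨ cong₂ _+_ (sumList-cong (subsets n) λ W → cong (f (false ◃ W) +_) (f-resp λ { zero → refl ; (suc a) → refl }))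
               (sumList-0 (subsets n)) ⟩
    Σsets n (λ W → f (false ◃ W) + f (true ◃ W)) + 0ℚ
  ≡⟨ +-identityʳ _ ⟩
    Σsets n (λ W → f (false ◃ W) + f (true ◃ W))
  ≡⟨ sumList-+ (subsets n) (λ W → f (false ◃ W)) (λ W → f (true ◃ W)) ⟩
    Σsets n (λ W → f (false ◃ W)) + Σsets n (λ W → f (true ◃ W))
  ≡⟨ sym (Σsets-suc f f-resp) ⟩
    Σsets (suc n) f ∎)
  where open ≡-Reasoning
Σsets-pair {suc n} (suc u) f f-resp = begin
    Σsets (suc n) f
  ≡⟨ Σsets-suc f f-resp ⟩
    Σsets n (λ W → f (false ◃ W)) + Σsets n (λ W → f (true ◃ W))
  ≡⟨ cong₂ _+_ (Σsets-pair u _ (λ V≗W → f-resp (◃-resp false V≗W)))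
               (Σsets-pair u _ (λ V≗W → f-resp (◃-resp true V≗W))) ⟩
    Σsets n (pairAt u (λ W → f (false ◃ W))) + Σsets n (pairAt u (λ W → f (true ◃ W)))
  ≡⟨ cong₂ _+_ (sumList-cong (subsets n) (shift false)) (sumList-cong (subsets n) (shift true)) ⟩
    Σsets n (λ W → pairAt (suc u) f (false ◃ W)) + Σsets n (λ W → pairAt (suc u) f (true ◃ W))
  ≡⟨ sym (Σsets-suc (pairAt (suc u) f) (pairAt-resp (suc u) f-resp)) ⟩
    Σsets (suc n) (pairAt (suc u) f) ∎
  where
  open ≡-Reasoning
  ◃-resp : ∀ b {V W : VertexSet n} → V ≗ W → b ◃ V ≗ b ◃ W
  ◃-resp b V≗W zero    = refl
  ◃-resp b V≗W (suc a) = V≗W a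
  ◃-set : ∀ b (W : VertexSet n) → b ◃ (W [ u ≔ true ]) ≗ (b ◃ W) [ suc u ≔ true ]
  ◃-set b W zero    = refl
  ◃-set b W (suc a) = cong (if_then true else W a) (sym (==-suc a u))
  shift : ∀ b W → pairAt u (λ V → f (b ◃ V)) W ≡ pairAt (suc u) f (b ◃ W)
  shift b W = cong (if W u then 0ℚ else_) (cong (f (b ◃ W) +_) (f-resp (◃-set b W)))

allBut : ∀ {n} → Fin n → Fin n → (Fin n → Bool) → Bool
allBut u v p = allF (λ a → a == u ∨ (a == v ∨ p a))

allF-at : ∀ {n} (u v : Fin n) (p : Fin n → Bool) → allF p ≡ p u ∧ (p v ∧ allBut u v p)
allF-at u v p = bool-ext
  (λ h → cong₂ _∧_ (allF-elim h u) (cong₂ _∧_ (allF-elim h v)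
           (allF-intro λ a → ∨-introʳ (a == u) (∨-introʳ (a == v) (allF-elim h a)))))
  (λ h → let (pu , h') = ∧-split {p u} h ; (pv , rest) = ∧-split {p v} h' in
           allF-intro λ a → elsewhere a pu pv (allF-elim rest a))
  where
  elsewhere : ∀ a → p u ≡ true → p v ≡ true → (a == u ∨ (a == v ∨ p a)) ≡ true → p a ≡ true
  elsewhere a pu pv h with a ≟ u
  ... | yes refl = pu
  ... | no _ with a ≟ v
  ...   | yes refl = pv
  ...   | no _ = h

allBut-cong : ∀ {n} (u v : Fin n) {p q : Fin n → Bool} → (∀ a → a ≢ u → a ≢ v → p a ≡ q a) →
  allBut u v p ≡ allBut u v q
allBut-cong u v {p} {q} h = allF-cong agree
  where
  agree : ∀ a → (a == u ∨ (a == v ∨ p a)) ≡ (a == u ∨ (a == v ∨ q a))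
  agree a with a ≟ u
  ... | yes _ = refl
  ... | no a≢u with a ≟ v
  ...   | yes _ = refl
  ...   | no a≢v = h a a≢u a≢v

covers : ∀ {n} → Gr n → VertexSet n → Fin n → Bool
covers K W a = (not (W a) ∨ vs K a) ∧ (not (vs K a) ∨ (W a ∨ anyF (λ b → W b ∧ E K b a)))

dominating-covers : ∀ {n} (K : Gr n) (W : VertexSet n) → dominating K W ≡ allF (covers K W)
dominating-covers K W =
  sym (allF-∧ (λ a → not (W a) ∨ vs K a) (λ a → not (vs K a) ∨ (W a ∨ anyF (λ b → W b ∧ E K b a))))

dominating-at : ∀ {n} (K : Gr n) (W : VertexSet n) (u v : Fin n) →
  dominating K W ≡ covers K W u ∧ (covers K W v ∧ allBut u v (covers K W))
dominating-at K W u v = trans (dominating-covers K W) (allF-at u v (covers K W))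

dominating-resp : ∀ {n} (K : Gr n) {V W : VertexSet n} → V ≗ W → dominating K V ≡ dominating K W
dominating-resp K V≗W = cong₂ _∧_
  (allF-cong λ a → cong (λ z → not z ∨ vs K a) (V≗W a))
  (allF-cong λ a → cong (λ z → not (vs K a) ∨ z)
    (cong₂ _∨_ (V≗W a) (anyF-cong λ b → cong (_∧ E K b a) (V≗W b))))

covers-at : ∀ {n} (K : Gr n) (W : VertexSet n) a {c} → vs K a ≡ c →
  covers K W a ≡ (not (W a) ∨ c) ∧ (not c ∨ (W a ∨ anyF (λ b → W b ∧ E K b a)))
covers-at K W a a∈K rewrite a∈K = refl

covers-inside : ∀ {n} (K : Gr n) (W : VertexSet n) a → vs K a ≡ true →
  covers K W a ≡ W a ∨ anyF (λ b → W b ∧ E K b a)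
covers-inside K W a a∈K rewrite a∈K with W a
... | true  = refl
... | false = refl

covers-outside : ∀ {n} (K : Gr n) (W : VertexSet n) a → vs K a ≡ false → covers K W a ≡ not (W a)
covers-outside K W a a∉K rewrite a∉K with W a
... | true  = refl
... | false = refl

-- Truth values of "W ∪ {u if s} ∪ {v if t} dominates K", for W avoiding u and v,
-- for K = G or G-e (domForm), K/u (contractForm) and K - N[u] (removeForm), in terms
-- of: e (is uv an edge of K), mu / mv (does W dominate u / v through G-edges), and
-- R s t (does W ∪ {u if s} ∪ {v if t} dominate every other vertex in G).
domForm contractForm removeForm : (e mu mv : Bool) → (Bool → Bool → Bool) → Bool → Bool → Bool
domForm e mu mv R s t = (s ∨ ((t ∧ e) ∨ mu)) ∧ ((t ∨ ((s ∧ e) ∨ mv)) ∧ R s t)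
contractForm e mu mv R s t = not s ∧ ((t ∨ (mv ∨ (mu ∧ e))) ∧ R ((e ∧ t) ∨ mu) t)
removeForm e mu mv R s t = not mu ∧ (not s ∧ (((not t ∨ not e) ∧ (e ∨ (t ∨ mv))) ∧ R true (not e ∧ t)))

domForm-cong : ∀ e mu mv s t {R R' : Bool → Bool → Bool} → (∀ a b → R a b ≡ R' a b) →
  domForm e mu mv R s t ≡ domForm e mu mv R' s t
domForm-cong e mu mv s t h = cong (λ z → (s ∨ ((t ∧ e) ∨ mu)) ∧ ((t ∨ ((s ∧ e) ∨ mv)) ∧ z)) (h s t)

contractForm-cong : ∀ e mu mv s t {R R' : Bool → Bool → Bool} → (∀ a b → R a b ≡ R' a b) →
  contractForm e mu mv R s t ≡ contractForm e mu mv R' s t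
contractForm-cong e mu mv s t h = cong (λ z → not s ∧ ((t ∨ (mv ∨ (mu ∧ e))) ∧ z)) (h _ t)

removeForm-cong : ∀ e mu mv s t {R R' : Bool → Bool → Bool} → (∀ a b → R a b ≡ R' a b) →
  removeForm e mu mv R s t ≡ removeForm e mu mv R' s t
removeForm-cong e mu mv s t h =
  cong (λ z → not mu ∧ (not s ∧ (((not t ∨ not e) ∧ (e ∨ (t ∨ mv))) ∧ z))) (h true _)

module Local {n} (G : SimpleGraph n) (u v : Fin n) (uv : adj G u v ≡ true)
             (W : VertexSet n) (u∉W : W u ≡ false) (v∉W : W v ≡ false) where

  v≢u : v ≢ u
  v≢u refl = false≢true (trans (sym (irrefl G u)) uv)

  ∈W⇒≢u : ∀ {b} → W b ≡ true → b ≢ u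
  ∈W⇒≢u b∈W refl = false≢true (trans (sym u∉W) b∈W)

  ∈W⇒≢v : ∀ {b} → W b ≡ true → b ≢ v
  ∈W⇒≢v b∈W refl = false≢true (trans (sym v∉W) b∈W)

  ext : Bool → Bool → VertexSet n
  ext s t = (W [ v ≔ t ]) [ u ≔ s ]

  ext-u : ∀ s t → ext s t u ≡ s
  ext-u s t = set-at (W [ v ≔ t ]) u s

  ext-v : ∀ s t → ext s t v ≡ t
  ext-v s t = trans (set-other (W [ v ≔ t ]) s v≢u) (set-at W v t)

  ext-other : ∀ s t a → a ≢ u → a ≢ v → ext s t a ≡ W a
  ext-other s t a a≢u a≢v = trans (set-other (W [ v ≔ t ]) s a≢u) (set-other W t a≢v)

  nbrW : Fin n → Bool
  nbrW a = anyF (λ b → W b ∧ adj G b a)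

  mu mv : Bool
  mu = nbrW u
  mv = nbrW v

  dominatedG : Bool → Bool → Fin n → Bool
  dominatedG s t a = W a ∨ ((s ∧ adj G u a) ∨ ((t ∧ adj G v a) ∨ nbrW a))

  R : Bool → Bool → Bool
  R s t = allBut u v (dominatedG s t)

  anyF-ext : ∀ s t (q : Fin n → Bool) →
    anyF (λ b → ext s t b ∧ q b) ≡ (s ∧ q u) ∨ ((t ∧ q v) ∨ anyF (λ b → W b ∧ q b))
  anyF-ext s t q = bool-ext to from
    where
    to : anyF (λ b → ext s t b ∧ q b) ≡ true → (s ∧ q u) ∨ ((t ∧ q v) ∨ anyF (λ b → W b ∧ q b)) ≡ true
    to h with anyF-elim h
    ... | b , hb with b ≟ u
    ...   | yes refl = cong (_∨ _) hb
    ...   | no _ with b ≟ v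
    ...     | yes refl = ∨-introʳ (s ∧ q u) (cong (_∨ _) hb)
    ...     | no _     = ∨-introʳ (s ∧ q u) (∨-introʳ (t ∧ q v) (anyF-intro b hb))
    from : (s ∧ q u) ∨ ((t ∧ q v) ∨ anyF (λ b → W b ∧ q b)) ≡ true → anyF (λ b → ext s t b ∧ q b) ≡ true
    from h with ∨-split {s ∧ q u} h
    ... | inj₁ hu = anyF-intro u (trans (cong (_∧ q u) (ext-u s t)) hu)
    ... | inj₂ h' with ∨-split {t ∧ q v} h'
    ...   | inj₁ hv = anyF-intro v (trans (cong (_∧ q v) (ext-v s t)) hv)
    ...   | inj₂ hW with anyF-elim hW
    ...     | b , hb = let b∈W = proj₁ (∧-split hb) in
                anyF-intro b (trans (cong (_∧ q b) (ext-other s t b (∈W⇒≢u b∈W) (∈W⇒≢v b∈W))) hb)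

  anyF-W-cong : ∀ {q q' : Fin n → Bool} → (∀ b → W b ≡ true → q b ≡ q' b) →
    anyF (λ b → W b ∧ q b) ≡ anyF (λ b → W b ∧ q' b)
  anyF-W-cong {q} {q'} h = anyF-cong agree
    where
    agree : ∀ b → W b ∧ q b ≡ W b ∧ q' b
    agree b with W b in b∈W
    ... | false = refl
    ... | true  = h b b∈W

  anyF-W-split : ∀ (p r : Fin n → Bool) c →
    anyF (λ b → W b ∧ (p b ∨ (r b ∧ c))) ≡ anyF (λ b → W b ∧ p b) ∨ (anyF (λ b → W b ∧ r b) ∧ c)
  anyF-W-split p r c = begin
      anyF (λ b → W b ∧ (p b ∨ (r b ∧ c)))
    ≡⟨ anyF-cong (λ b → trans (∧-distribˡ-∨ (W b) (p b) (r b ∧ c)) (cong (W b ∧ p b ∨_) (sym (∧-assoc (W b) (r b) c)))) ⟩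
      anyF (λ b → (W b ∧ p b) ∨ ((W b ∧ r b) ∧ c))
    ≡⟨ anyF-∨ (λ b → W b ∧ p b) (λ b → (W b ∧ r b) ∧ c) ⟩
      anyF (λ b → W b ∧ p b) ∨ anyF (λ b → (W b ∧ r b) ∧ c)
    ≡⟨ cong (anyF (λ b → W b ∧ p b) ∨_) (anyF-∧ʳ (λ b → W b ∧ r b) c) ⟩
      anyF (λ b → W b ∧ p b) ∨ (anyF (λ b → W b ∧ r b) ∧ c) ∎
    where open ≡-Reasoning

  anyF-W-∧ʳ : ∀ (p : Fin n → Bool) c → anyF (λ b → W b ∧ (p b ∧ c)) ≡ anyF (λ b → W b ∧ p b) ∧ c
  anyF-W-∧ʳ p c = trans (anyF-cong λ b → sym (∧-assoc (W b) (p b) c)) (anyF-∧ʳ (λ b → W b ∧ p b) c)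

  -- A graph on all vertices that agrees with G except possibly on the pair
  -- {u, v}, where the adjacency is e: G itself (e = true) and G - e (e = false).
  record AgreesOffEdge (K : Gr n) (e : Bool) : Set where
    field
      full    : ∀ a → vs K a ≡ true
      agreeˡ  : ∀ a b → a ≢ u → a ≢ v → E K a b ≡ adj G a b
      agreeʳ  : ∀ a b → b ≢ u → b ≢ v → E K a b ≡ adj G a b
      edge-uv : E K u v ≡ e
      edge-vu : E K v u ≡ e

  module _ (K : Gr n) (e : Bool) (K≈G : AgreesOffEdge K e) where
    open AgreesOffEdge K≈G

    covers-u : ∀ s t → covers K (ext s t) u ≡ s ∨ ((t ∧ e) ∨ mu)
    covers-u s t
      rewrite covers-inside K (ext s t) u (full u) | ext-u s t | anyF-ext s t (λ b → E K b u) | edge-vu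
            | anyF-W-cong {λ b → E K b u} {λ b → adj G b u} (λ b b∈W → agreeˡ b u (∈W⇒≢u b∈W) (∈W⇒≢v b∈W))
            = absorb s (E K u u) _
      where
      absorb : ∀ s z r → s ∨ ((s ∧ z) ∨ r) ≡ s ∨ r
      absorb = decide 3 _ _ tt

    covers-v : ∀ s t → covers K (ext s t) v ≡ t ∨ ((s ∧ e) ∨ mv)
    covers-v s t
      rewrite covers-inside K (ext s t) v (full v) | ext-v s t | anyF-ext s t (λ b → E K b v) | edge-uv
            | anyF-W-cong {λ b → E K b v} {λ b → adj G b v} (λ b b∈W → agreeˡ b v (∈W⇒≢u b∈W) (∈W⇒≢v b∈W))
            = absorb s t (E K v v) e _
      where
      absorb : ∀ s t z y r → t ∨ ((s ∧ y) ∨ ((t ∧ z) ∨ r)) ≡ t ∨ ((s ∧ y) ∨ r)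
      absorb = decide 5 _ _ tt

    covers-other : ∀ s t a → a ≢ u → a ≢ v → covers K (ext s t) a ≡ dominatedG s t a
    covers-other s t a a≢u a≢v
      rewrite covers-inside K (ext s t) a (full a) | ext-other s t a a≢u a≢v | anyF-ext s t (λ b → E K b a)
            | agreeʳ u a a≢u a≢v | agreeʳ v a a≢u a≢v
            | anyF-W-cong {λ b → E K b a} {λ b → adj G b a} (λ b _ → agreeʳ b a a≢u a≢v)
            = refl

    dominating-ext : ∀ s t → dominating K (ext s t) ≡ domForm e mu mv R s t
    dominating-ext s t = trans (dominating-at K (ext s t) u v)
      (cong₂ _∧_ (covers-u s t) (cong₂ _∧_ (covers-v s t) (allBut-cong u v (covers-other s t))))

    vs-contract : ∀ a → vs (contract K u) a ≡ not (a == u)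
    vs-contract a rewrite full a = refl

    E-contract : ∀ a b → E (contract K u) a b ≡
      not (a == u) ∧ (not (b == u) ∧ (E K a b ∨ (E K a u ∧ (E K u b ∧ not (a == b)))))
    E-contract a b rewrite full a | full b = refl

    covers-contract-u : ∀ s t → covers (contract K u) (ext s t) u ≡ not s
    covers-contract-u s t
      rewrite covers-outside (contract K u) (ext s t) u (trans (vs-contract u) (cong not (==-refl u)))
            | ext-u s t = refl

    from-u-contract : ∀ b → E (contract K u) u b ≡ false
    from-u-contract b rewrite E-contract u b | ==-refl u = refl

    contract-edge : ∀ a b → a ≢ u → a ≢ v → b ≢ u → b ≢ v → a ≢ b →
      E (contract K u) a b ≡ adj G a b ∨ (adj G a u ∧ adj G u b)
    contract-edge a b a≢u a≢v b≢u b≢v a≢b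
      rewrite E-contract a b | ==-≢ a≢u | ==-≢ b≢u | agreeʳ a b b≢u b≢v | agreeˡ a u a≢u a≢v
            | agreeʳ u b b≢u b≢v | ==-≢ a≢b
            = cong (λ z → adj G a b ∨ (adj G a u ∧ z)) (∧-identityʳ (adj G u b))

    contract-edge-to-v : ∀ b → b ≢ u → b ≢ v → E (contract K u) b v ≡ adj G b v ∨ (adj G b u ∧ e)
    contract-edge-to-v b b≢u b≢v
      rewrite E-contract b v | ==-≢ b≢u | ==-≢ v≢u | agreeˡ b v b≢u b≢v | agreeˡ b u b≢u b≢v | edge-uv
            | ==-≢ b≢v = cong (λ z → adj G b v ∨ (adj G b u ∧ z)) (∧-identityʳ e)

    contract-edge-from-v : ∀ a → a ≢ u → a ≢ v → E (contract K u) v a ≡ adj G v a ∨ (e ∧ adj G u a)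
    contract-edge-from-v a a≢u a≢v
      rewrite E-contract v a | ==-≢ v≢u | ==-≢ a≢u | agreeʳ v a a≢u a≢v | edge-vu | agreeʳ u a a≢u a≢v
            | ==-≢ (λ v≡a → a≢v (sym v≡a)) = cong (λ z → adj G v a ∨ (e ∧ z)) (∧-identityʳ (adj G u a))

    covers-contract-v : ∀ s t → covers (contract K u) (ext s t) v ≡ t ∨ (mv ∨ (mu ∧ e))
    covers-contract-v s t
      rewrite covers-inside (contract K u) (ext s t) v (trans (vs-contract v) (cong not (==-≢ v≢u)))
            | ext-v s t | anyF-ext s t (λ b → E (contract K u) b v) | from-u-contract v
            | anyF-W-cong {λ b → E (contract K u) b v} {λ b → adj G b v ∨ (adj G b u ∧ e)}
                (λ b b∈W → contract-edge-to-v b (∈W⇒≢u b∈W) (∈W⇒≢v b∈W))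
            | anyF-W-split (λ b → adj G b v) (λ b → adj G b u) e
            = absorb t s (E (contract K u) v v) mv (mu ∧ e)
      where
      absorb : ∀ t s z m r → t ∨ ((s ∧ false) ∨ ((t ∧ z) ∨ (m ∨ r))) ≡ t ∨ (m ∨ r)
      absorb = decide 5 _ _ tt

    -- Any other vertex a is dominated in K/u as in G, with u counted as
    -- chosen when some chosen vertex was adjacent to u in K.
    covers-contract-other : ∀ s t a → a ≢ u → a ≢ v →
      covers (contract K u) (ext s t) a ≡ dominatedG ((e ∧ t) ∨ mu) t a
    covers-contract-other s t a a≢u a≢v
      rewrite covers-inside (contract K u) (ext s t) a (trans (vs-contract a) (cong not (==-≢ a≢u)))
            | ext-other s t a a≢u a≢v | anyF-ext s t (λ b → E (contract K u) b a) | from-u-contract a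
            with W a in a∈W
    ... | true  = refl
    ... | false
      rewrite contract-edge-from-v a a≢u a≢v
            | anyF-W-cong {λ b → E (contract K u) b a} {λ b → adj G b a ∨ (adj G b u ∧ adj G u a)}
                (λ b b∈W → contract-edge b a (∈W⇒≢u b∈W) (∈W⇒≢v b∈W) a≢u a≢v
                  (λ b≡a → false≢true (trans (sym a∈W) (subst (λ z → W z ≡ true) b≡a b∈W))))
            | anyF-W-split (λ b → adj G b a) (λ b → adj G b u) (adj G u a)
            = regroup s t e mu (adj G u a) (adj G v a) (nbrW a)
      where
      regroup : ∀ s t e m au av r →
        (s ∧ false) ∨ ((t ∧ (av ∨ (e ∧ au))) ∨ (r ∨ (m ∧ au))) ≡ ((((e ∧ t) ∨ m) ∧ au) ∨ ((t ∧ av) ∨ r))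
      regroup = decide 7 _ _ tt

    dominating-contract : ∀ s t → dominating (contract K u) (ext s t) ≡ contractForm e mu mv R s t
    dominating-contract s t = trans (dominating-at (contract K u) (ext s t) u v)
      (cong₂ _∧_ (covers-contract-u s t)
        (cong₂ _∧_ (covers-contract-v s t) (allBut-cong u v (covers-contract-other s t))))

    vs-remove : ∀ a → vs (removeClosedNbhd K u) a ≡ not (a == u ∨ E K u a)
    vs-remove a rewrite full a = refl

    E-remove : ∀ a b → E (removeClosedNbhd K u) a b ≡
      not (a == u ∨ E K u a) ∧ (not (b == u ∨ E K u b) ∧ E K a b)
    E-remove a b rewrite full a | full b | full u = refl

    -- If some w ∈ W is adjacent to u, then w lies in the removed set, so no
    -- extension of W is a subset of the vertices of K - N[u].
    remove-blocked : ∀ s t w → W w ≡ true → adj G w u ≡ true →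
      dominating (removeClosedNbhd K u) (ext s t) ≡ false
    remove-blocked s t w w∈W wu = trans (dominating-covers (removeClosedNbhd K u) (ext s t))
      (allF-refute w (trans (covers-outside (removeClosedNbhd K u) (ext s t) w w-removed)
                            (cong not (trans (ext-other s t w (∈W⇒≢u w∈W) (∈W⇒≢v w∈W)) w∈W))))
      where
      w-removed : vs (removeClosedNbhd K u) w ≡ false
      w-removed rewrite vs-remove w | ==-≢ (∈W⇒≢u w∈W) | agreeʳ u w (∈W⇒≢u w∈W) (∈W⇒≢v w∈W)
                      | SimpleGraph.sym G u w | wu = refl

    -- Otherwise the members of W survive, keeping their G-adjacencies.
    module Unblocked (mu-false : mu ≡ false) where

      u-not-nbr : ∀ b → W b ≡ true → adj G u b ≡ false
      u-not-nbr b b∈W = trans (SimpleGraph.sym G u b)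
        (subst (λ z → z ∧ adj G b u ≡ false) b∈W (anyF-none mu-false b))

      from-u-remove : ∀ b → E (removeClosedNbhd K u) u b ≡ false
      from-u-remove b rewrite E-remove u b | ==-refl u = refl

      covers-remove-u : ∀ s t → covers (removeClosedNbhd K u) (ext s t) u ≡ not s
      covers-remove-u s t
        rewrite covers-outside (removeClosedNbhd K u) (ext s t) u
                  (trans (vs-remove u) (cong (λ z → not (z ∨ E K u u)) (==-refl u)))
              | ext-u s t = refl

      remove-edge-to-v : ∀ b → W b ≡ true → E (removeClosedNbhd K u) b v ≡ adj G b v ∧ not e
      remove-edge-to-v b b∈W
        rewrite E-remove b v | ==-≢ (∈W⇒≢u b∈W) | agreeʳ u b (∈W⇒≢u b∈W) (∈W⇒≢v b∈W) | u-not-nbr b b∈W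
              | ==-≢ v≢u | edge-uv | agreeˡ b v (∈W⇒≢u b∈W) (∈W⇒≢v b∈W)
              = ∧-comm (not e) (adj G b v)

      remove-edge : ∀ b a → W b ≡ true → a ≢ u → a ≢ v →
        E (removeClosedNbhd K u) b a ≡ adj G b a ∧ not (adj G u a)
      remove-edge b a b∈W a≢u a≢v
        rewrite E-remove b a | ==-≢ (∈W⇒≢u b∈W) | agreeʳ u b (∈W⇒≢u b∈W) (∈W⇒≢v b∈W) | u-not-nbr b b∈W
              | ==-≢ a≢u | agreeʳ u a a≢u a≢v | agreeʳ b a a≢u a≢v
              = ∧-comm (not (adj G u a)) (adj G b a)

      remove-edge-from-v : ∀ a → a ≢ u → a ≢ v →
        E (removeClosedNbhd K u) v a ≡ not e ∧ (not (adj G u a) ∧ adj G v a)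
      remove-edge-from-v a a≢u a≢v
        rewrite E-remove v a | ==-≢ v≢u | edge-uv | ==-≢ a≢u | agreeʳ u a a≢u a≢v | agreeʳ v a a≢u a≢v
              = refl

      -- v survives iff uv ∉ K; then it must be chosen or have a neighbour in W.
      covers-remove-v : ∀ s t → covers (removeClosedNbhd K u) (ext s t) v ≡ (not t ∨ not e) ∧ (e ∨ (t ∨ mv))
      covers-remove-v s t
        rewrite covers-at (removeClosedNbhd K u) (ext s t) v {not e}
                  (trans (vs-remove v) (cong₂ (λ z y → not (z ∨ y)) (==-≢ v≢u) edge-uv))
              | ext-v s t | anyF-ext s t (λ b → E (removeClosedNbhd K u) b v) | from-u-remove v
              | anyF-W-cong {λ b → E (removeClosedNbhd K u) b v} {λ b → adj G b v ∧ not e} remove-edge-to-v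
              | anyF-W-∧ʳ (λ b → adj G b v) (not e)
              = simplify t e s (E (removeClosedNbhd K u) v v) mv
        where
        simplify : ∀ t e s z m → (not t ∨ not e) ∧ (not (not e) ∨ (t ∨ ((s ∧ false) ∨ ((t ∧ z) ∨ (m ∧ not e)))))
                                 ≡ (not t ∨ not e) ∧ (e ∨ (t ∨ m))
        simplify = decide 5 _ _ tt

      -- Another vertex a survives iff it is not adjacent to u; then it is
      -- dominated as in G with u counted as chosen (its neighbours are gone)
      -- and v counted only when it survives.
      covers-remove-other : ∀ s t a → a ≢ u → a ≢ v →
        covers (removeClosedNbhd K u) (ext s t) a ≡ dominatedG true (not e ∧ t) a
      covers-remove-other s t a a≢u a≢v
        rewrite covers-at (removeClosedNbhd K u) (ext s t) a {not (adj G u a)}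
                  (trans (vs-remove a) (cong₂ (λ z y → not (z ∨ y)) (==-≢ a≢u) (agreeʳ u a a≢u a≢v)))
              | ext-other s t a a≢u a≢v | anyF-ext s t (λ b → E (removeClosedNbhd K u) b a)
              | from-u-remove a | remove-edge-from-v a a≢u a≢v
              | anyF-W-cong {λ b → E (removeClosedNbhd K u) b a} {λ b → adj G b a ∧ not (adj G u a)}
                  (λ b b∈W → remove-edge b a b∈W a≢u a≢v)
              | anyF-W-∧ʳ (λ b → adj G b a) (not (adj G u a))
              = simplify (W a) (adj G u a) (adj G v a) (nbrW a) s t e a∉N[u]
        where
        a∉N[u] : W a ∧ adj G u a ≡ false
        a∉N[u] with W a in a∈W
        ... | false = refl
        ... | true  = u-not-nbr a a∈W
        simplify : ∀ w au av r s t e → w ∧ au ≡ false →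
          (not w ∨ not au) ∧ (not (not au) ∨ (w ∨ ((s ∧ false) ∨ ((t ∧ (not e ∧ (not au ∧ av))) ∨ (r ∧ not au)))))
            ≡ w ∨ ((true ∧ au) ∨ (((not e ∧ t) ∧ av) ∨ r))
        simplify true  au av r s t e w∧au rewrite w∧au = refl
        simplify false au av r s t e _ = unblocked au av r s t e
          where
          unblocked : ∀ au av r s t e →
            (not false ∨ not au) ∧ (not (not au) ∨ (false ∨ ((s ∧ false) ∨ ((t ∧ (not e ∧ (not au ∧ av))) ∨ (r ∧ not au)))))
              ≡ false ∨ ((true ∧ au) ∨ (((not e ∧ t) ∧ av) ∨ r))
          unblocked = decide 6 _ _ tt

    dominating-remove : ∀ s t → dominating (removeClosedNbhd K u) (ext s t) ≡ removeForm e mu mv R s t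
    dominating-remove s t with mu in mu-value
    ... | true  = let (w , w∈W∧wu) = anyF-elim mu-value ; (w∈W , wu) = ∧-split {W w} w∈W∧wu in
                  remove-blocked s t w w∈W wu
    ... | false = trans (dominating-at (removeClosedNbhd K u) (ext s t) u v)
                    (cong₂ _∧_ (covers-remove-u s t)
                      (cong₂ _∧_ (covers-remove-v s t) (allBut-cong u v (covers-remove-other s t))))
      where open Unblocked mu-value

record Profile : Set where
  constructor profile
  field dG dGe dGe/u dGe/v dG/u dG/v dG-Nu dG-Nv dGe-Nu dGe-Nv : Bool
open Profile

profile-cong : ∀ {a₁ a₂ a₃ a₄ a₅ a₆ a₇ a₈ a₉ a₁₀ b₁ b₂ b₃ b₄ b₅ b₆ b₇ b₈ b₉ b₁₀} →
  a₁ ≡ b₁ → a₂ ≡ b₂ → a₃ ≡ b₃ → a₄ ≡ b₄ → a₅ ≡ b₅ → a₆ ≡ b₆ → a₇ ≡ b₇ → a₈ ≡ b₈ → a₉ ≡ b₉ → a₁₀ ≡ b₁₀ →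
  profile a₁ a₂ a₃ a₄ a₅ a₆ a₇ a₈ a₉ a₁₀ ≡ profile b₁ b₂ b₃ b₄ b₅ b₆ b₇ b₈ b₉ b₁₀
profile-cong refl refl refl refl refl refl refl refl refl refl = refl

-- The profile of W ∪ {u if s} ∪ {v if t}; the v-side graphs are the
-- u-side ones with the roles of (u, s, mu) and (v, t, mv) exchanged.
localProfile : (mu mv : Bool) → (Bool → Bool → Bool) → Bool → Bool → Profile
localProfile mu mv R s t = profile
  (domForm true mu mv R s t)       (domForm false mu mv R s t)
  (contractForm false mu mv R s t) (contractForm false mv mu Rᵀ t s)
  (contractForm true mu mv R s t)  (contractForm true mv mu Rᵀ t s)
  (removeForm true mu mv R s t)    (removeForm true mv mu Rᵀ t s)
  (removeForm false mu mv R s t)   (removeForm false mv mu Rᵀ t s)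
  where Rᵀ = λ a b → R b a

localProfile-cong : ∀ mu mv {R R' : Bool → Bool → Bool} → (∀ a b → R a b ≡ R' a b) →
  ∀ s t → localProfile mu mv R s t ≡ localProfile mu mv R' s t
localProfile-cong mu mv h s t = profile-cong
  (domForm-cong true mu mv s t h)       (domForm-cong false mu mv s t h)
  (contractForm-cong false mu mv s t h) (contractForm-cong false mv mu t s hᵀ)
  (contractForm-cong true mu mv s t h)  (contractForm-cong true mv mu t s hᵀ)
  (removeForm-cong true mu mv s t h)    (removeForm-cong true mv mu t s hᵀ)
  (removeForm-cong false mu mv s t h)   (removeForm-cong false mv mu t s hᵀ)
  where hᵀ = λ a b → h b a

table : (r₀₀ r₁₀ r₀₁ r₁₁ : Bool) → Bool → Bool → Bool
table r₀₀ r₁₀ r₀₁ r₁₁ false false = r₀₀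
table r₀₀ r₁₀ r₀₁ r₁₁ true  false = r₁₀
table r₀₀ r₁₀ r₀₁ r₁₁ false true  = r₀₁
table r₀₀ r₁₀ r₀₁ r₁₁ true  true  = r₁₁

table-of : ∀ (R : Bool → Bool → Bool) a b → R a b ≡ table (R false false) (R true false) (R false true) (R true true) a b
table-of R false false = refl
table-of R true  false = refl
table-of R false true  = refl
table-of R true  true  = refl

ι : Bool → ℚ
ι b = if b then 1ℚ else 0ℚ

bracket : (a b c d e f g h : ℚ) → ℚ
bracket a b c d e f g h = a + b - c - d - e - f + g + h

δ β : Profile → ℚ
δ p = ι (dG p) - ι (dGe p)
β p = bracket (ι (dGe/u p)) (ι (dGe/v p)) (ι (dG/u p)) (ι (dG/v p))
              (ι (dG-Nu p)) (ι (dG-Nv p)) (ι (dGe-Nu p)) (ι (dGe-Nv p))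

-- The coefficient with which a vertex set of size k contributes x^k to
-- (x - 1)(D(G) - D(G-e)) - x·[bracket].
coefficient : ℚ → Profile → ℚ
coefficient x p = (x - 1ℚ) * δ p - x * β p

open TruthTable _≟ℚ_ renaming (decide to decideℚ)

-- Five finite facts about the local profiles, verified on all 2⁶ values of
-- mu, mv and the table of R:
-- deleting e does not matter when neither or both endpoints are chosen,
δ-none : ∀ mu mv r₀₀ r₁₀ r₀₁ r₁₁ → δ (localProfile mu mv (table r₀₀ r₁₀ r₀₁ r₁₁) false false) ≡ 0ℚ
δ-none = decideℚ 6 _ _ tt

δ-both : ∀ mu mv r₀₀ r₁₀ r₀₁ r₁₁ → δ (localProfile mu mv (table r₀₀ r₁₀ r₀₁ r₁₁) true true) ≡ 0ℚ
δ-both = decideℚ 6 _ _ tt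

-- a set containing both endpoints dominates none of the eight derived graphs
-- (each of them lacks u or v),
β-both : ∀ mu mv r₀₀ r₁₀ r₀₁ r₁₁ → β (localProfile mu mv (table r₀₀ r₁₀ r₀₁ r₁₁) true true) ≡ 0ℚ
β-both = decideℚ 6 _ _ tt

-- and the bracket of the sets with no / exactly one endpoint balances the
-- effect of deleting e on the sets with exactly one endpoint.
β-none : ∀ mu mv r₀₀ r₁₀ r₀₁ r₁₁ → let P = localProfile mu mv (table r₀₀ r₁₀ r₀₁ r₁₁) in
  β (P false false) ≡ - (δ (P true false) + δ (P false true))
β-none = decideℚ 6 _ _ tt

β-one : ∀ mu mv r₀₀ r₁₀ r₀₁ r₁₁ → let P = localProfile mu mv (table r₀₀ r₁₀ r₀₁ r₁₁) in
  β (P false true) ≡ (δ (P true false) + δ (P false true)) - β (P true false)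
β-one = decideℚ 6 _ _ tt

-- The algebra behind the cancellation: with d = δ and b = β at the four
-- extensions, and weights x^k, x^(k+1), x^(k+1), x^(k+2), the five facts
-- make the weighted coefficients sum to zero.
four-term-cancellation : ∀ x y (d b : Bool → Bool → ℚ) →
  d false false ≡ 0ℚ → d true true ≡ 0ℚ → b true true ≡ 0ℚ →
  b false false ≡ - (d true false + d false true) →
  b false true ≡ (d true false + d false true) - b true false →
  let c = λ s t → (x - 1ℚ) * d s t - x * b s t in
  (y * c false false + (x * y) * c true false) + ((x * y) * c false true + (x * (x * y)) * c true true) ≡ 0ℚ
four-term-cancellation x y d b d₀₀ d₁₁ b₁₁ b₀₀ b₀₁ rewrite d₀₀ | d₁₁ | b₁₁ | b₀₀ | b₀₁ =
  solve 5 (λ X Y p q r →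
      (Y :* ((X :- con 1ℚ) :* con 0ℚ :- X :* (:- (p :+ q)))
        :+ (X :* Y) :* ((X :- con 1ℚ) :* p :- X :* r))
      :+ ((X :* Y) :* ((X :- con 1ℚ) :* q :- X :* ((p :+ q) :- r))
        :+ (X :* (X :* Y)) :* ((X :- con 1ℚ) :* con 0ℚ :- X :* con 0ℚ))
      := con 0ℚ)
    refl x y (d true false) (d false true) (b true false)

block-cancels : ∀ x k mu mv r₀₀ r₁₀ r₀₁ r₁₁ →
  let c = λ s t → x ^ (bit s ℕ.+ (bit t ℕ.+ k)) * coefficient x (localProfile mu mv (table r₀₀ r₁₀ r₀₁ r₁₁) s t)
  in (c false false + c true false) + (c false true + c true true) ≡ 0ℚ
block-cancels x k mu mv r₀₀ r₁₀ r₀₁ r₁₁ =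
  four-term-cancellation x (x ^ k) (λ s t → δ (P s t)) (λ s t → β (P s t))
    (δ-none mu mv r₀₀ r₁₀ r₀₁ r₁₁) (δ-both mu mv r₀₀ r₁₀ r₀₁ r₁₁) (β-both mu mv r₀₀ r₁₀ r₀₁ r₁₁)
    (β-none mu mv r₀₀ r₁₀ r₀₁ r₁₁) (β-one mu mv r₀₀ r₁₀ r₀₁ r₁₁)
  where P = localProfile mu mv (table r₀₀ r₁₀ r₀₁ r₁₁)

_⟨_⟩ : ℚ → Bool → ℚ
w ⟨ b ⟩ = if b then w else 0ℚ

weighted-ι : ∀ w b → w ⟨ b ⟩ ≡ ι b * w
weighted-ι w true  = sym (*-identityˡ w)
weighted-ι w false = sym (*-zeroˡ w)

coefficient-scaled : ∀ x w p → w * coefficient x p ≡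
  (x - 1ℚ) * (w ⟨ dG p ⟩ - w ⟨ dGe p ⟩)
  - x * bracket (w ⟨ dGe/u p ⟩) (w ⟨ dGe/v p ⟩) (w ⟨ dG/u p ⟩) (w ⟨ dG/v p ⟩)
                (w ⟨ dG-Nu p ⟩) (w ⟨ dG-Nv p ⟩) (w ⟨ dGe-Nu p ⟩) (w ⟨ dGe-Nv p ⟩)
coefficient-scaled x w p
  rewrite weighted-ι w (dG p) | weighted-ι w (dGe p) | weighted-ι w (dGe/u p) | weighted-ι w (dGe/v p)
        | weighted-ι w (dG/u p) | weighted-ι w (dG/v p) | weighted-ι w (dG-Nu p) | weighted-ι w (dG-Nv p)
        | weighted-ι w (dGe-Nu p) | weighted-ι w (dGe-Nv p) =
  solve 12 (λ X w a b c d e f g h i j →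
      w :* ((X :- con 1ℚ) :* (a :- b) :- X :* (c :+ d :- e :- f :- g :- h :+ i :+ j))
    := (X :- con 1ℚ) :* (a :* w :- b :* w)
       :- X :* (c :* w :+ d :* w :- e :* w :- f :* w :- g :* w :- h :* w :+ i :* w :+ j :* w))
    refl x w (ι (dG p)) (ι (dGe p)) (ι (dGe/u p)) (ι (dGe/v p)) (ι (dG/u p)) (ι (dG/v p))
    (ι (dG-Nu p)) (ι (dG-Nv p)) (ι (dGe-Nu p)) (ι (dGe-Nv p))

solve-for : ∀ x a b .{{_ : NonZero (x - 1ℚ)}} → (x - 1ℚ) * a - x * b ≡ 0ℚ → a ≡ (x ÷ (x - 1ℚ)) * b
solve-for x a b eq = begin
    a
  ≡⟨ solve 1 (λ a → a := a :* con 1ℚ) refl a ⟩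
    a * 1ℚ
  ≡⟨ cong (a *_) (sym (*-inverseʳ (x - 1ℚ))) ⟩
    a * ((x - 1ℚ) * i)
  ≡⟨ solve 4 (λ a X i b → a :* ((X :- con 1ℚ) :* i) := i :* ((X :- con 1ℚ) :* a :- X :* b) :+ (X :* i) :* b)
       refl a x i b ⟩
    i * ((x - 1ℚ) * a - x * b) + (x * i) * b
  ≡⟨ cong (λ z → i * z + (x * i) * b) eq ⟩
    i * 0ℚ + (x * i) * b
  ≡⟨ solve 3 (λ i X b → i :* con 0ℚ :+ (X :* i) :* b := (X :* i) :* b) refl i x b ⟩
    (x * i) * b ∎
  where
  open ≡-Reasoning
  i = 1/ (x - 1ℚ)

set-same : ∀ {n} (W : VertexSet n) u {b} → W u ≡ b → W [ u ≔ b ] ≗ W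
set-same W u Wu≡b a with a ≟ u
... | yes refl = sym Wu≡b
... | no  _    = refl

bracket-+ : ∀ a₁ a₂ a₃ a₄ a₅ a₆ a₇ a₈ b₁ b₂ b₃ b₄ b₅ b₆ b₇ b₈ →
  bracket a₁ a₂ a₃ a₄ a₅ a₆ a₇ a₈ + bracket b₁ b₂ b₃ b₄ b₅ b₆ b₇ b₈ ≡
  bracket (a₁ + b₁) (a₂ + b₂) (a₃ + b₃) (a₄ + b₄) (a₅ + b₅) (a₆ + b₆) (a₇ + b₇) (a₈ + b₈)
bracket-+ = solve 16 (λ a₁ a₂ a₃ a₄ a₅ a₆ a₇ a₈ b₁ b₂ b₃ b₄ b₅ b₆ b₇ b₈ →
    (a₁ :+ a₂ :- a₃ :- a₄ :- a₅ :- a₆ :+ a₇ :+ a₈) :+ (b₁ :+ b₂ :- b₃ :- b₄ :- b₅ :- b₆ :+ b₇ :+ b₈)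
  := (a₁ :+ b₁) :+ (a₂ :+ b₂) :- (a₃ :+ b₃) :- (a₄ :+ b₄) :- (a₅ :+ b₅) :- (a₆ :+ b₆) :+ (a₇ :+ b₇) :+ (a₈ :+ b₈))
  refl

sumList-bracket : ∀ {n} (xs : List (VertexSet n)) (f₁ f₂ f₃ f₄ f₅ f₆ f₇ f₈ : VertexSet n → ℚ) →
  sumList xs (λ W → bracket (f₁ W) (f₂ W) (f₃ W) (f₄ W) (f₅ W) (f₆ W) (f₇ W) (f₈ W)) ≡
  bracket (sumList xs f₁) (sumList xs f₂) (sumList xs f₃) (sumList xs f₄)
          (sumList xs f₅) (sumList xs f₆) (sumList xs f₇) (sumList xs f₈)
sumList-bracket []       f₁ f₂ f₃ f₄ f₅ f₆ f₇ f₈ = refl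
sumList-bracket (W ∷ xs) f₁ f₂ f₃ f₄ f₅ f₆ f₇ f₈ =
  trans (cong (bracket (f₁ W) (f₂ W) (f₃ W) (f₄ W) (f₅ W) (f₆ W) (f₇ W) (f₈ W) +_)
              (sumList-bracket xs f₁ f₂ f₃ f₄ f₅ f₆ f₇ f₈))
        (bracket-+ (f₁ W) (f₂ W) (f₃ W) (f₄ W) (f₅ W) (f₆ W) (f₇ W) (f₈ W) _ _ _ _ _ _ _ _)

module Assembly {n} (G : SimpleGraph n) (u v : Fin n) (uv : adj G u v ≡ true) (x : ℚ) where

  H He : Gr n
  H  = toGr G
  He = deleteEdge H u v

  vu : adj G v u ≡ true
  vu = trans (SimpleGraph.sym G v u) uv

  u≢v : u ≢ v
  u≢v refl = false≢true (trans (sym (irrefl G u)) uv)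

  profileOf : VertexSet n → Profile
  profileOf W = profile
    (dominating H W) (dominating He W) (dominating (contract He u) W) (dominating (contract He v) W)
    (dominating (contract H u) W) (dominating (contract H v) W)
    (dominating (removeClosedNbhd H u) W) (dominating (removeClosedNbhd H v) W)
    (dominating (removeClosedNbhd He u) W) (dominating (removeClosedNbhd He v) W)

  bracketD : ℚ
  bracketD = bracket (D (contract He u) x) (D (contract He v) x) (D (contract H u) x) (D (contract H v) x)
                     (D (removeClosedNbhd H u) x) (D (removeClosedNbhd H v) x)
                     (D (removeClosedNbhd He u) x) (D (removeClosedNbhd He v) x)

  Φ : VertexSet n → ℚ
  Φ W = x ^ card W * coefficient x (profileOf W)

  profileOf-resp : ∀ {V W} → V ≗ W → profileOf V ≡ profileOf W
  profileOf-resp V≗W = profile-cong (dom H) (dom He) (dom (contract He u)) (dom (contract He v))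
    (dom (contract H u)) (dom (contract H v)) (dom (removeClosedNbhd H u)) (dom (removeClosedNbhd H v))
    (dom (removeClosedNbhd He u)) (dom (removeClosedNbhd He v))
    where dom = λ K → dominating-resp K V≗W

  Φ-resp : Respects≗ Φ
  Φ-resp V≗W = cong₂ (λ k p → x ^ k * coefficient x p) (card-cong V≗W) (profileOf-resp V≗W)

  module _ (W : VertexSet n) (u∉W : W u ≡ false) (v∉W : W v ≡ false) where
    open Local G u v uv W u∉W v∉W
    module V = Local G v u vu W v∉W u∉W

    G-agrees : AgreesOffEdge H true
    G-agrees = record
      { full = λ _ → refl ; agreeˡ = λ _ _ _ _ → refl ; agreeʳ = λ _ _ _ _ → refl
      ; edge-uv = uv ; edge-vu = vu }

    G-e-agrees : AgreesOffEdge He false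
    G-e-agrees = record
      { full = λ _ → refl ; agreeˡ = agreeˡ ; agreeʳ = agreeʳ ; edge-uv = edge-uv ; edge-vu = edge-vu }
      where
      agreeˡ : ∀ a b → a ≢ u → a ≢ v → E He a b ≡ adj G a b
      agreeˡ a b a≢u a≢v rewrite ==-≢ a≢u | ==-≢ a≢v = ∧-identityʳ (adj G a b)
      agreeʳ : ∀ a b → b ≢ u → b ≢ v → E He a b ≡ adj G a b
      agreeʳ a b b≢u b≢v rewrite ==-≢ b≢u | ==-≢ b≢v | ∧-zeroʳ (a == u) | ∧-zeroʳ (a == v) =
        ∧-identityʳ (adj G a b)
      edge-uv : E He u v ≡ false
      edge-uv rewrite ==-refl u | ==-refl v = ∧-zeroʳ (adj G u v)
      edge-vu : E He v u ≡ false
      edge-vu rewrite ==-refl u | ==-refl v | ∨-zeroʳ ((v == u) ∧ (u == v)) = ∧-zeroʳ (adj G v u)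

    swapped : ∀ {K e} → AgreesOffEdge K e → V.AgreesOffEdge K e
    swapped K≈G = record
      { full = full ; agreeˡ = λ a b a≢v a≢u → agreeˡ a b a≢u a≢v
      ; agreeʳ = λ a b b≢v b≢u → agreeʳ a b b≢u b≢v ; edge-uv = edge-vu ; edge-vu = edge-uv }
      where open AgreesOffEdge K≈G

    ext-swap : ∀ s t → V.ext t s ≗ ext s t
    ext-swap s t a = by-cases (a ≟ u) (a ≟ v)
      where
      by-cases : Dec (a ≡ u) → Dec (a ≡ v) → V.ext t s a ≡ ext s t a
      by-cases (yes refl) _          = trans (V.ext-v t s) (sym (ext-u s t))
      by-cases (no _)     (yes refl) = trans (V.ext-u t s) (sym (ext-v s t))
      by-cases (no a≢u)   (no a≢v)   = trans (V.ext-other t s a a≢v a≢u) (sym (ext-other s t a a≢u a≢v))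

    R-swap : ∀ a b → V.R a b ≡ R b a
    R-swap a b = allF-cong λ c → reorder (c == v) (c == u) (W c) a (adj G v c) b (adj G u c) (nbrW c)
      where
      reorder : ∀ cv cu w a av b au r → (cv ∨ (cu ∨ (w ∨ ((a ∧ av) ∨ ((b ∧ au) ∨ r)))))
                                      ≡ (cu ∨ (cv ∨ (w ∨ ((b ∧ au) ∨ ((a ∧ av) ∨ r)))))
      reorder = decide 8 _ _ tt

    contract-v : ∀ {K e} → AgreesOffEdge K e → ∀ s t →
      dominating (contract K v) (ext s t) ≡ contractForm e mv mu (λ a b → R b a) t s
    contract-v {K} {e} K≈G s t = trans (sym (dominating-resp (contract K v) (ext-swap s t)))
      (trans (V.dominating-contract K e (swapped K≈G) t s) (contractForm-cong e mv mu t s R-swap))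

    remove-v : ∀ {K e} → AgreesOffEdge K e → ∀ s t →
      dominating (removeClosedNbhd K v) (ext s t) ≡ removeForm e mv mu (λ a b → R b a) t s
    remove-v {K} {e} K≈G s t = trans (sym (dominating-resp (removeClosedNbhd K v) (ext-swap s t)))
      (trans (V.dominating-remove K e (swapped K≈G) t s) (removeForm-cong e mv mu t s R-swap))

    profile-ext : ∀ s t → profileOf (ext s t) ≡ localProfile mu mv R s t
    profile-ext s t = profile-cong
      (dominating-ext H true G-agrees s t)          (dominating-ext He false G-e-agrees s t)
      (dominating-contract He false G-e-agrees s t) (contract-v G-e-agrees s t)
      (dominating-contract H true G-agrees s t)     (contract-v G-agrees s t)
      (dominating-remove H true G-agrees s t)       (remove-v G-agrees s t)
      (dominating-remove He false G-e-agrees s t)   (remove-v G-e-agrees s t)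

    card-ext : ∀ s t → card (ext s t) ≡ bit s ℕ.+ (bit t ℕ.+ card W)
    card-ext s t = trans (card-set (W [ v ≔ t ]) u s (trans (set-other W t u≢v) u∉W))
                         (cong (bit s ℕ.+_) (card-set W v t v∉W))

    Φ-ext : ∀ s t → Φ (ext s t) ≡ x ^ (bit s ℕ.+ (bit t ℕ.+ card W))
      * coefficient x (localProfile mu mv (table (R false false) (R true false) (R false true) (R true true)) s t)
    Φ-ext s t = cong₂ (λ k p → x ^ k * coefficient x p) (card-ext s t)
      (trans (profile-ext s t) (localProfile-cong mu mv (table-of R) s t))

    block-zero : (Φ W + Φ (W [ u ≔ true ])) + (Φ (W [ v ≔ true ]) + Φ ((W [ v ≔ true ]) [ u ≔ true ])) ≡ 0ℚ
    block-zero = trans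
      (cong₂ _+_ (cong₂ _+_ (trans (Φ-resp (λ a → sym (none a))) (Φ-ext false false))
                            (trans (Φ-resp (λ a → sym (only-u a))) (Φ-ext true false)))
                 (cong₂ _+_ (trans (Φ-resp (λ a → sym (only-v a))) (Φ-ext false true))
                            (Φ-ext true true)))
      (block-cancels x (card W) mu mv (R false false) (R true false) (R false true) (R true true))
      where
      u∉W+v : ∀ b → (W [ v ≔ b ]) u ≡ false
      u∉W+v b = trans (set-other W b u≢v) u∉W
      none : ext false false ≗ W
      none a = trans (set-same (W [ v ≔ false ]) u (u∉W+v false) a) (set-same W v v∉W a)
      only-u : ext true false ≗ W [ u ≔ true ]
      only-u = set-resp u true (set-same W v v∉W)
      only-v : ext false true ≗ W [ v ≔ true ]
      only-v = set-same (W [ v ≔ true ]) u (u∉W+v true)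

  ΣΦ≡0 : Σsets n Φ ≡ 0ℚ
  ΣΦ≡0 = begin
      Σsets n Φ
    ≡⟨ Σsets-pair u Φ Φ-resp ⟩
      Σsets n (pairAt u Φ)
    ≡⟨ Σsets-pair v (pairAt u Φ) (pairAt-resp u Φ-resp) ⟩
      Σsets n (pairAt v (pairAt u Φ))
    ≡⟨ sumList-cong (subsets n) quadruple-zero ⟩
      Σsets n (λ _ → 0ℚ)
    ≡⟨ sumList-0 (subsets n) ⟩
      0ℚ ∎
    where
    open ≡-Reasoning
    quadruple-zero : ∀ W → pairAt v (pairAt u Φ) W ≡ 0ℚ
    quadruple-zero W = by-membership (W v) refl (W u) refl
      where
      u∈W+v⇔u∈W : (W [ v ≔ true ]) u ≡ W u
      u∈W+v⇔u∈W = set-other W true u≢v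
      by-membership : ∀ bv → W v ≡ bv → ∀ bu → W u ≡ bu → pairAt v (pairAt u Φ) W ≡ 0ℚ
      by-membership true  v∈W _     _   = pairAt-present v (pairAt u Φ) W v∈W
      by-membership false v∉W true  u∈W = trans (pairAt-absent v (pairAt u Φ) W v∉W)
        (cong₂ _+_ (pairAt-present u Φ W u∈W) (pairAt-present u Φ (W [ v ≔ true ]) (trans u∈W+v⇔u∈W u∈W)))
      by-membership false v∉W false u∉W = trans (pairAt-absent v (pairAt u Φ) W v∉W)
        (trans (cong₂ _+_ (pairAt-absent u Φ W u∉W) (pairAt-absent u Φ (W [ v ≔ true ]) (trans u∈W+v⇔u∈W u∉W)))
               (block-zero W u∉W v∉W))

  ΣΦ≡identity : Σsets n Φ ≡ (x - 1ℚ) * (D H x - D He x) - x * bracketD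
  ΣΦ≡identity = begin
      Σsets n Φ
    ≡⟨ sumList-cong (subsets n) (λ W → coefficient-scaled x (x ^ card W) (profileOf W)) ⟩
      Σsets n (λ W → (x - 1ℚ) * (τ H W - τ He W) - x * B W)
    ≡⟨ sumList-- (subsets n) (λ W → (x - 1ℚ) * (τ H W - τ He W)) (λ W → x * B W) ⟩
      Σsets n (λ W → (x - 1ℚ) * (τ H W - τ He W)) - Σsets n (λ W → x * B W)
    ≡⟨ cong₂ _-_ (trans (sumList-* (subsets n) (x - 1ℚ) (λ W → τ H W - τ He W)) (cong ((x - 1ℚ) *_) (sumList-- (subsets n) (τ H) (τ He))))
                 (trans (sumList-* (subsets n) x B) (cong (x *_) (sumList-bracket (subsets n)
                   (τ (contract He u)) (τ (contract He v)) (τ (contract H u)) (τ (contract H v))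
                   (τ (removeClosedNbhd H u)) (τ (removeClosedNbhd H v))
                   (τ (removeClosedNbhd He u)) (τ (removeClosedNbhd He v))))) ⟩
      (x - 1ℚ) * (D H x - D He x) - x * bracketD ∎
    where
    open ≡-Reasoning
    τ : Gr n → VertexSet n → ℚ
    τ K W = (x ^ card W) ⟨ dominating K W ⟩
    B : VertexSet n → ℚ
    B W = bracket (τ (contract He u) W) (τ (contract He v) W) (τ (contract H u) W) (τ (contract H v) W)
                  (τ (removeClosedNbhd H u) W) (τ (removeClosedNbhd H v) W)
                  (τ (removeClosedNbhd He u) W) (τ (removeClosedNbhd He v) W)

mainTheorem2 : ∀ {n} (G : SimpleGraph n) (u v : Fin n) → adj G u v ≡ true →
  (x : ℚ) → .{{_ : NonZero (x - 1ℚ)}} →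
  let H = toGr G
      He = deleteEdge H u v
  in D H x ≡ D He x + (x ÷ (x - 1ℚ)) *
       ( D (contract He u) x + D (contract He v) x
       - D (contract H u) x - D (contract H v) x
       - D (removeClosedNbhd H u) x - D (removeClosedNbhd H v) x
       + D (removeClosedNbhd He u) x + D (removeClosedNbhd He v) x )
mainTheorem2 G u v uv x = begin
    D H x
  ≡⟨ solve 2 (λ a b → a := b :+ (a :- b)) refl (D H x) (D He x) ⟩
    D He x + (D H x - D He x)
  ≡⟨ cong (D He x +_) (solve-for x (D H x - D He x) bracketD (trans (sym ΣΦ≡identity) ΣΦ≡0)) ⟩
    D He x + (x ÷ (x - 1ℚ)) * bracketD ∎
  where
  open ≡-Reasoning
  open Assembly G u v uv x
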